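{- Let $X$ be a weighted sequence of length $n$ over an alphabet $\Sigma$, let $z>0$, and fix a position $i\in\{1,\ldots,n\}$. There exists a unique multiset $\mathcal{M}_i$ of strings such that every string $P$ is a prefix of exactly $t_i(P)$ strings in $\mathcal{M}_i$, where $t_i(P)=\lfloor\mathcal{P}_X(P,i)z\rfloor$.
   Context: A weighted sequence $X$ of length $n$ over $\Sigma$ assigns to every position $i$ and letter $c$ a probability $p_i(c)\ge0$ with $\sum_c p_i(c)=1$. For a string $P$ and position $i$, $\mathcal{P}_X(P,i)=\prod_{j=1}^{|P|}p_{i+j-1}(P[j])$, which is $0$ if $P$ extends beyond position $n$, and $\mathcal{P}_X(\varepsilon,i)=1$. Prefixes are counted with multiplicity in the multiset.
   Formalization: The probabilities $p_i(c)$ and the parameter $z$ take values in ℚ. -}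

module Defs where

open import Data.Nat using (ℕ; zero; suc; _<?_)
open import Data.Product using (_×_)
open import Data.Fin using (Fin; fromℕ<; toℕ; zero; suc)
open import Data.Fin.Properties using (_≟_)
open import Data.Rational using (ℚ; 0ℚ; 1ℚ; _+_; _*_; _≤_; floor)
open import Data.Integer using (ℤ)
open import Data.List using (List; []; _∷_; length; filter)
open import Data.List.Relation.Binary.Prefix.Heterogeneous using (Prefix)
open import Data.List.Relation.Binary.Prefix.Heterogeneous.Properties using (prefix?)
open import Relation.Binary.PropositionalEquality using (_≡_)
open import Relation.Nullary using (yes; no)

Str : ℕ → Set
Str σ = List (Fin σ)

-- A weighted sequence of length n over Fin σ: p i c, positions 0-based.
WSeq : ℕ → ℕ → Set
WSeq n σ = Fin n → Fin σ → ℚ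

sumFin : ∀ {k} → (Fin k → ℚ) → ℚ
sumFin {zero}  f = 0ℚ
sumFin {suc k} f = f zero + sumFin (λ c → f (suc c))

IsWeighted : ∀ {n σ} → WSeq n σ → Set
IsWeighted {n} {σ} X =
  (∀ (i : Fin n) (c : Fin σ) → 0ℚ ≤ X i c) × (∀ (i : Fin n) → sumFin (X i) ≡ 1ℚ)

probAt : ∀ {n σ} → WSeq n σ → ℕ → Fin σ → ℚ
probAt {n} X j c with j <? n
... | yes j<n = X (fromℕ< j<n) c
... | no  _   = 0ℚ

-- 𝒫_X(P, j) = ∏_{k} p_{j+k}(P[k]); equals 0 if P extends beyond n; 𝒫_X(ε, j) = 1
occProb : ∀ {n σ} → WSeq n σ → Str σ → ℕ → ℚ
occProb X []      j = 1ℚ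
occProb X (c ∷ P) j = probAt X j c * occProb X P (suc j)

t : ∀ {n σ} → WSeq n σ → ℚ → Fin n → Str σ → ℤ
t X z i P = floor (occProb X P (toℕ i) * z)

-- number of strings in the multiset M (a list, counted with multiplicity)
-- having P as a prefix
prefixCount : ∀ {σ} → Str σ → List (Str σ) → ℕ
prefixCount P M = length (filter (prefix? _≟_ P) M)

-- Uniqueness: two multisets with the same prefix counts share a longest string (it is a prefix of
-- some string of the other multiset, which is in turn a prefix of a string of the first); remove it
-- from both and induct. Existence: a count function f on strings that vanishes on long strings and
-- satisfies Σ_c f(Qc) ≤ f(Q) is realised by the multiset holding f(Q) − Σ_c f(Qc) copies of each Q.
-- t_i qualifies because 𝒫_X(Qc,i) = 𝒫_X(Q,i)·p_{i+|Q|}(c), the letter probabilities at a position sum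
-- to at most 1, and ⌊·⌋ is superadditive.
module Submission where

open import Defs
open import Algebra.Bundles using (CommutativeRing)
import Algebra.Properties.CommutativeMonoid.Sum as CommutativeMonoidSum
import Algebra.Properties.Semiring.Sum as SemiringSum
open import Data.Empty using (⊥-elim)
open import Data.Fin using (Fin; zero; suc; punchIn; toℕ; fromℕ<)
open import Data.Fin.Properties using (_≟_; punchInᵢ≢i)
open import Data.Integer as ℤ using (+_; ∣_∣; pred)
import Data.Integer.Properties as ℤ
open import Data.Integer.DivMod using (div-pos-is-/ℕ; [n/d]*d≤n; n<s[n/ℕd]*d; _/ℕ_)
open import Data.List
  using (List; []; _∷_; [_]; _++_; _∷ʳ_; length; filter; map; replicate; concat; tabulate; initLast; _∷ʳ′_)
open import Data.List.Properties
  using (filter-accept; filter-reject; filter-some; filter-++; filter-all; filter-none;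
         length-++; length-map; length-replicate)
open import Data.List.Extrema.Nat using (argmax; argmax-sel; f[⊥]≤f[argmax]; f[xs]≤f[argmax])
open import Data.List.Membership.Propositional using (_∈_; find)
open import Data.List.Membership.Propositional.Properties using (∈-∃++)
open import Data.List.Relation.Unary.All as All using (All; _∷_)
open import Data.List.Relation.Unary.All.Properties using (map⁺; replicate⁺)
open import Data.List.Relation.Unary.Any as Any using (Any; here; there)
open import Data.List.Relation.Binary.Pointwise as Pointwise using (Pointwise-≡⇒≡)
open import Data.List.Relation.Binary.Prefix.Heterogeneous using (Prefix; []; _∷_)
open import Data.List.Relation.Binary.Prefix.Heterogeneous.Properties
  using (prefix?; length-mono; fromPointwise; toPointwise)
open import Data.List.Relation.Binary.Permutation.Propositional using (_↭_; ↭-refl; ↭-sym; ↭-trans; prep)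
open import Data.List.Relation.Binary.Permutation.Propositional.Properties using (↭-length; filter-↭; shift)
open import Data.Nat using (ℕ; zero; suc; _+_; _∸_; _≤_; _<_; z≤n; s≤s; s≤s⁻¹; _<?_)
import Data.Nat.Properties as ℕ
open import Data.Product using (Σ; ∃-syntax; _×_; _,_; proj₁; proj₂)
open import Data.Rational as ℚ using (ℚ; mkℚ; 0ℚ; 1ℚ; floor; toℚᵘ; nonNegative)
import Data.Rational.Properties as ℚ
open import Data.Rational.Unnormalised as ℚᵘ using (*≤*; *≡*)
import Data.Rational.Unnormalised.Properties as ℚᵘ
open import Data.Sum using ([_,_]′)
open import Function using (_∘_; case_of_)
open import Relation.Binary.PropositionalEquality
  using (_≡_; _≢_; refl; sym; trans; cong; cong₂; subst; module ≡-Reasoning)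
open import Relation.Nullary using (yes; no; ¬_)

open CommutativeMonoidSum ℕ.+-0-commutativeMonoid using (sum; sum-syntax; sum-remove; sum-cong-≗; sum-replicate-zero)
module ℤΣ = CommutativeMonoidSum ℤ.+-0-commutativeMonoid
module ℚΣ = SemiringSum (CommutativeRing.semiring ℚ.+-*-commutativeRing)

_⊑_ : ∀ {A : Set} → List A → List A → Set
_⊑_ = Prefix _≡_

⊑-refl : ∀ {A : Set} (xs : List A) → xs ⊑ xs
⊑-refl xs = fromPointwise (Pointwise.refl refl)

⊑-antisym-length : ∀ {A : Set} {xs ys : List A} → xs ⊑ ys → length ys ≤ length xs → xs ≡ ys
⊑-antisym-length xs⊑ys ys≤xs =
  Pointwise-≡⇒≡ (toPointwise (ℕ.≤-antisym (length-mono xs⊑ys) ys≤xs) xs⊑ys)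

∈⇒↭∷ : ∀ {A : Set} {x : A} {xs} → x ∈ xs → ∃[ ys ] xs ↭ x ∷ ys
∈⇒↭∷ {x = x} x∈xs with ∈-∃++ x∈xs
... | ys , zs , refl = ys ++ zs , shift x ys zs

sum-supported-at : ∀ {k} (f : Fin k → ℕ) c → (∀ c′ → c′ ≢ c → f c′ ≡ 0) → sum f ≡ f c
sum-supported-at {suc k} f c vanish = begin
  sum f                      ≡⟨ sum-remove f ⟩
  f c + sum (f ∘ punchIn c)  ≡⟨ cong (_+_ (f c)) (sum-cong-≗ (λ c′ → vanish (punchIn c c′) (punchInᵢ≢i c c′))) ⟩
  f c + sum {k} (λ _ → 0)    ≡⟨ cong (_+_ (f c)) (sum-replicate-zero k) ⟩
  f c + 0                    ≡⟨ ℕ.+-identityʳ (f c) ⟩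
  f c                        ∎
  where open ≡-Reasoning

module _ {σ : ℕ} where

  prefixCount-accept : ∀ {P x : Str σ} L → P ⊑ x → prefixCount P (x ∷ L) ≡ suc (prefixCount P L)
  prefixCount-accept L P⊑x = cong length (filter-accept (prefix? _≟_ _) P⊑x)

  prefixCount-reject : ∀ {P x : Str σ} L → ¬ P ⊑ x → prefixCount P (x ∷ L) ≡ prefixCount P L
  prefixCount-reject L P⋢x = cong length (filter-reject (prefix? _≟_ _) P⋢x)

  prefixCount-resp-↭ : ∀ (P : Str σ) {A B} → A ↭ B → prefixCount P A ≡ prefixCount P B
  prefixCount-resp-↭ P A↭B = ↭-length (filter-↭ (prefix? _≟_ P) A↭B)

  prefixCount-∷-cancel : ∀ (P x : Str σ) {A B} →
    prefixCount P (x ∷ A) ≡ prefixCount P (x ∷ B) → prefixCount P A ≡ prefixCount P B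
  prefixCount-∷-cancel P x eq with prefix? _≟_ P x
  ... | yes _ = ℕ.suc-injective eq
  ... | no  _ = eq

  prefixCount-pos⇒Any : ∀ {P : Str σ} L → 0 < prefixCount P L → Any (P ⊑_) L
  prefixCount-pos⇒Any {P} (x ∷ L) pos with prefix? _≟_ P x
  ... | yes P⊑x = here P⊑x
  ... | no  _   = there (prefixCount-pos⇒Any L pos)

  ∈⇒prefixCount-pos : ∀ {x : Str σ} {L} → x ∈ L → 0 < prefixCount x L
  ∈⇒prefixCount-pos {x} x∈L = filter-some (prefix? _≟_ x) (Any.map (λ { refl → ⊑-refl x }) x∈L)

  longest-∈ : ∀ {A B : List (Str σ)} {m} → m ∈ A → All (λ w → length w ≤ length m) A →
    (∀ P → prefixCount P A ≡ prefixCount P B) → m ∈ B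
  longest-∈ {A} {B} {m} m∈A longest same
    with find (prefixCount-pos⇒Any B (subst (0 <_) (same m) (∈⇒prefixCount-pos m∈A)))
  ... | y , y∈B , m⊑y
    with find (prefixCount-pos⇒Any A (subst (0 <_) (sym (same y)) (∈⇒prefixCount-pos y∈B)))
  ... | w , w∈A , y⊑w
    rewrite ⊑-antisym-length m⊑y (ℕ.≤-trans (length-mono y⊑w) (All.lookup longest w∈A)) = y∈B

  private
    ↭-fromPrefixCount : ∀ k {A B : List (Str σ)} → length A ≡ k →
      (∀ P → prefixCount P A ≡ prefixCount P B) → A ↭ B
    ↭-fromPrefixCount _ {[]} {[]} _ _ = ↭-refl
    ↭-fromPrefixCount _ {[]} {_ ∷ _} _ same with same []
    ... | ()
    ↭-fromPrefixCount (suc k) {x ∷ A} {B} len same =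
      ↭-trans xA↭mA′ (↭-trans (prep m (↭-fromPrefixCount k len′ same′)) (↭-sym B↭mB′))
      where
      m : Str σ
      m = argmax length x A
      m∈xA : m ∈ x ∷ A
      m∈xA = [ here , there ]′ (argmax-sel length x A)
      longest : All (λ w → length w ≤ length m) (x ∷ A)
      longest = f[⊥]≤f[argmax] {f = length} x A ∷ f[xs]≤f[argmax] {f = length} x A
      m∈B : m ∈ B
      m∈B = longest-∈ {B = B} m∈xA longest same
      A′ B′ : List (Str σ)
      A′ = proj₁ (∈⇒↭∷ m∈xA)
      B′ = proj₁ (∈⇒↭∷ m∈B)
      xA↭mA′ : x ∷ A ↭ m ∷ A′
      xA↭mA′ = proj₂ (∈⇒↭∷ m∈xA)
      B↭mB′ : B ↭ m ∷ B′
      B↭mB′ = proj₂ (∈⇒↭∷ m∈B)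
      len′ : length A′ ≡ k
      len′ = ℕ.suc-injective (trans (sym (↭-length xA↭mA′)) len)
      same′ : ∀ P → prefixCount P A′ ≡ prefixCount P B′
      same′ P = prefixCount-∷-cancel P m
        (trans (sym (prefixCount-resp-↭ P xA↭mA′)) (trans (same P) (prefixCount-resp-↭ P B↭mB′)))

  prefixCount-injective : ∀ {A B : List (Str σ)} → (∀ P → prefixCount P A ≡ prefixCount P B) → A ↭ B
  prefixCount-injective = ↭-fromPrefixCount _ refl

  prefixCount-[] : ∀ (L : List (Str σ)) → prefixCount [] L ≡ length L
  prefixCount-[] L = cong length (filter-all (prefix? _≟_ []) (All.universal (λ _ → []) L))

  prefixCount-++ : ∀ (P : Str σ) A B → prefixCount P (A ++ B) ≡ prefixCount P A + prefixCount P B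
  prefixCount-++ P A B = trans (cong length (filter-++ (prefix? _≟_ P) A B)) (length-++ (filter _ A))

  prefixCount-concat : ∀ {k} (P : Str σ) (Ls : Fin k → List (Str σ)) →
    prefixCount P (concat (tabulate Ls)) ≡ ∑[ c < k ] prefixCount P (Ls c)
  prefixCount-concat {zero}  P Ls = refl
  prefixCount-concat {suc k} P Ls =
    trans (prefixCount-++ P (Ls zero) _) (cong (_+_ (prefixCount P (Ls zero))) (prefixCount-concat P (Ls ∘ suc)))

  prefixCount-∷-replicate-[] : ∀ c (P : Str σ) k → prefixCount (c ∷ P) (replicate k []) ≡ 0
  prefixCount-∷-replicate-[] c P k = cong length (filter-none (prefix? _≟_ (c ∷ P)) (replicate⁺ k λ ()))

  prefixCount-∷-map-∷ : ∀ c (P : Str σ) L → prefixCount (c ∷ P) (map (c ∷_) L) ≡ prefixCount P L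
  prefixCount-∷-map-∷ c P []      = refl
  prefixCount-∷-map-∷ c P (x ∷ L) = case prefix? _≟_ P x of λ where
      (yes P⊑x) → begin
        prefixCount (c ∷ P) (map (c ∷_) (x ∷ L))  ≡⟨ prefixCount-accept (map (c ∷_) L) (refl ∷ P⊑x) ⟩
        suc (prefixCount (c ∷ P) (map (c ∷_) L))  ≡⟨ cong suc (prefixCount-∷-map-∷ c P L) ⟩
        suc (prefixCount P L)                     ≡⟨ prefixCount-accept L P⊑x ⟨
        prefixCount P (x ∷ L)                     ∎
      (no P⋢x) → begin
        prefixCount (c ∷ P) (map (c ∷_) (x ∷ L))  ≡⟨ prefixCount-reject {x = c ∷ x} (map (c ∷_) L) (λ { (_ ∷ P⊑x) → P⋢x P⊑x }) ⟩
        prefixCount (c ∷ P) (map (c ∷_) L)        ≡⟨ prefixCount-∷-map-∷ c P L ⟩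
        prefixCount P L                           ≡⟨ prefixCount-reject L P⋢x ⟨
        prefixCount P (x ∷ L)                     ∎
    where open ≡-Reasoning

  prefixCount-∷-map-≢ : ∀ {c d} (P : Str σ) L → d ≢ c → prefixCount (c ∷ P) (map (d ∷_) L) ≡ 0
  prefixCount-∷-map-≢ {c} P L d≢c =
    cong length (filter-none (prefix? _≟_ (c ∷ P)) (map⁺ (All.universal (λ _ → λ { (c≡d ∷ _) → d≢c (sym c≡d) }) L)))

  branches : (Fin σ → List (Str σ)) → List (Str σ)
  branches Ls = concat (tabulate λ c → map (c ∷_) (Ls c))

  prefixCount-[]-branches : ∀ Ls → prefixCount [] (branches Ls) ≡ ∑[ c < σ ] prefixCount [] (Ls c)
  prefixCount-[]-branches Ls = trans (prefixCount-concat [] (λ c → map (c ∷_) (Ls c))) (sum-cong-≗ λ c →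
    trans (prefixCount-[] (map (c ∷_) (Ls c))) (trans (length-map (c ∷_) (Ls c)) (sym (prefixCount-[] (Ls c)))))

  prefixCount-∷-branches : ∀ c (P : Str σ) Ls → prefixCount (c ∷ P) (branches Ls) ≡ prefixCount P (Ls c)
  prefixCount-∷-branches c P Ls = begin
    prefixCount (c ∷ P) (branches Ls)                  ≡⟨ prefixCount-concat (c ∷ P) (λ d → map (d ∷_) (Ls d)) ⟩
    ∑[ d < σ ] prefixCount (c ∷ P) (map (d ∷_) (Ls d))  ≡⟨ sum-supported-at _ c (λ d → prefixCount-∷-map-≢ P (Ls d)) ⟩
    prefixCount (c ∷ P) (map (c ∷_) (Ls c))            ≡⟨ prefixCount-∷-map-∷ c P (Ls c) ⟩
    prefixCount P (Ls c)                               ∎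
    where open ≡-Reasoning

  fromPrefixCounts : (Str σ → ℕ) → ℕ → List (Str σ)
  fromPrefixCounts f zero    = []
  fromPrefixCounts f (suc d) =
    replicate (f [] ∸ ∑[ c < σ ] f [ c ]) [] ++ branches λ c → fromPrefixCounts (f ∘ (c ∷_)) d

  prefixCount-fromPrefixCounts : ∀ d (f : Str σ → ℕ) →
    (∀ Q → d ≤ length Q → f Q ≡ 0) → (∀ Q → ∑[ c < σ ] f (Q ∷ʳ c) ≤ f Q) →
    ∀ P → prefixCount P (fromPrefixCounts f d) ≡ f P
  prefixCount-fromPrefixCounts zero    f vanish children P = sym (vanish P z≤n)
  prefixCount-fromPrefixCounts (suc d) f vanish children P = begin
    prefixCount P (replicate k [] ++ branches Ls)                ≡⟨ prefixCount-++ P (replicate k []) _ ⟩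
    prefixCount P (replicate k []) + prefixCount P (branches Ls) ≡⟨ counts P ⟩
    f P                                                          ∎
    where
    open ≡-Reasoning
    k : ℕ
    k = f [] ∸ ∑[ c < σ ] f [ c ]
    Ls : Fin σ → List (Str σ)
    Ls c = fromPrefixCounts (f ∘ (c ∷_)) d
    ih : ∀ c P → prefixCount P (Ls c) ≡ f (c ∷ P)
    ih c = prefixCount-fromPrefixCounts d (f ∘ (c ∷_)) (λ Q d≤Q → vanish (c ∷ Q) (s≤s d≤Q)) (children ∘ (c ∷_))
    counts : ∀ P → prefixCount P (replicate k []) + prefixCount P (branches Ls) ≡ f P
    counts []      = begin
      prefixCount [] (replicate k []) + prefixCount [] (branches Ls)
        ≡⟨ cong₂ _+_ (trans (prefixCount-[] (replicate k [])) (length-replicate k)) (prefixCount-[]-branches Ls) ⟩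
      k + ∑[ c < σ ] prefixCount [] (Ls c)  ≡⟨ cong (_+_ k) (sum-cong-≗ λ c → ih c []) ⟩
      k + ∑[ c < σ ] f [ c ]                ≡⟨ ℕ.m∸n+n≡m (children []) ⟩
      f []                                  ∎
    counts (c ∷ P) = cong₂ _+_ (prefixCount-∷-replicate-[] c P k) (trans (prefixCount-∷-branches c P Ls) (ih c P))

floor-≤ : ∀ p → floor p ℚᵘ./ 1 ℚᵘ.≤ toℚᵘ p
floor-≤ p@(mkℚ n d _) = *≤* (begin
  floor p ℤ.* + suc d  ≤⟨ [n/d]*d≤n n (+ suc d) ⟩
  n                    ≡⟨ ℤ.*-identityʳ n ⟨
  n ℤ.* + 1            ∎)
  where open ℤ.≤-Reasoning

≤-floor : ∀ k p → k ℚᵘ./ 1 ℚᵘ.≤ toℚᵘ p → k ℤ.≤ floor p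
≤-floor k p@(mkℚ n d _) (*≤* k*d≤n*1) = begin
  k               ≤⟨ ℤ.i<j⇒i≤pred[j] {j = ℤ.suc q} (ℤ.*-cancelʳ-<-nonNeg (+ suc d) k*d<[q+1]*d) ⟩
  pred (ℤ.suc q)  ≡⟨ ℤ.pred-suc q ⟩
  q               ≡⟨ div-pos-is-/ℕ n (suc d) ⟨
  floor p         ∎
  where
  open ℤ.≤-Reasoning
  q = n /ℕ suc d
  k*d<[q+1]*d : k ℤ.* + suc d ℤ.< ℤ.suc q ℤ.* + suc d
  k*d<[q+1]*d = ℤ.≤-<-trans (subst (k ℤ.* + suc d ℤ.≤_) (ℤ.*-identityʳ n) k*d≤n*1) (n<s[n/ℕd]*d n (suc d))

floor-mono : ∀ {p q} → p ℚ.≤ q → floor p ℤ.≤ floor q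
floor-mono {p} {q} p≤q = ≤-floor (floor p) q (ℚᵘ.≤-trans (floor-≤ p) (ℚ.toℚᵘ-mono-≤ p≤q))

/1-homo-+ : ∀ i j → (i ℤ.+ j) ℚᵘ./ 1 ℚᵘ.≃ i ℚᵘ./ 1 ℚᵘ.+ j ℚᵘ./ 1
/1-homo-+ i j = *≡* (cong (ℤ._* + 1) (sym (cong₂ ℤ._+_ (ℤ.*-identityʳ i) (ℤ.*-identityʳ j))))

floor-superadditive : ∀ p q → floor p ℤ.+ floor q ℤ.≤ floor (p ℚ.+ q)
floor-superadditive p q = ≤-floor _ (p ℚ.+ q) (begin
  (floor p ℤ.+ floor q) ℚᵘ./ 1        ≃⟨ /1-homo-+ (floor p) (floor q) ⟩
  floor p ℚᵘ./ 1 ℚᵘ.+ floor q ℚᵘ./ 1  ≤⟨ ℚᵘ.+-mono-≤ (floor-≤ p) (floor-≤ q) ⟩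
  toℚᵘ p ℚᵘ.+ toℚᵘ q                  ≃⟨ ℚ.toℚᵘ-homo-+ p q ⟨
  toℚᵘ (p ℚ.+ q)                      ∎)
  where open ℚᵘ.≤-Reasoning

sum-floor≤floor-sumFin : ∀ {k} (x : Fin k → ℚ) → ℤΣ.sum (floor ∘ x) ℤ.≤ floor (sumFin x)
sum-floor≤floor-sumFin {zero}  x = ℤ.≤-refl
sum-floor≤floor-sumFin {suc k} x = ℤ.≤-trans
  (ℤ.+-monoʳ-≤ (floor (x zero)) (sum-floor≤floor-sumFin (x ∘ suc)))
  (floor-superadditive (x zero) (sumFin (x ∘ suc)))

+-sum : ∀ {k} (f : Fin k → ℕ) → + sum f ≡ ℤΣ.sum (+_ ∘ f)
+-sum {zero}  f = refl
+-sum {suc k} f = trans (ℤ.pos-+ (f zero) _) (cong (ℤ._+_ (+ f zero)) (+-sum (f ∘ suc)))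

sumFin≡sum : ∀ {k} (f : Fin k → ℚ) → sumFin f ≡ ℚΣ.sum f
sumFin≡sum {zero}  f = refl
sumFin≡sum {suc k} f = cong (ℚ._+_ (f zero)) (sumFin≡sum (f ∘ suc))

*-nonNeg : ∀ {p q} → 0ℚ ℚ.≤ p → 0ℚ ℚ.≤ q → 0ℚ ℚ.≤ p ℚ.* q
*-nonNeg {p} {q} 0≤p 0≤q =
  ℚ.nonNegative⁻¹ (p ℚ.* q) {{ℚ.nonNeg*nonNeg⇒nonNeg p {{nonNegative 0≤p}} q {{nonNegative 0≤q}}}}

0≤1 : 0ℚ ℚ.≤ 1ℚ
0≤1 = ℚ.<⇒≤ (ℚ.positive⁻¹ 1ℚ)

module _ {n σ : ℕ} (X : WSeq n σ) where

  probAt-< : ∀ {k} (k<n : k < n) c → probAt X k c ≡ X (fromℕ< k<n) c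
  probAt-< {k} k<n c with k <? n
  ... | yes _   = refl
  ... | no  k≮n = ⊥-elim (k≮n k<n)

  probAt-≥ : ∀ {k} → n ≤ k → ∀ c → probAt X k c ≡ 0ℚ
  probAt-≥ {k} n≤k c with k <? n
  ... | yes k<n = ⊥-elim (ℕ.<⇒≱ k<n n≤k)
  ... | no  _   = refl

  occProb-∷ʳ : ∀ Q j c → occProb X (Q ∷ʳ c) j ≡ occProb X Q j ℚ.* probAt X (j + length Q) c
  occProb-∷ʳ []      j c = begin
    probAt X j c ℚ.* 1ℚ        ≡⟨ ℚ.*-identityʳ _ ⟩
    probAt X j c               ≡⟨ cong (λ k → probAt X k c) (ℕ.+-identityʳ j) ⟨
    probAt X (j + 0) c         ≡⟨ ℚ.*-identityˡ _ ⟨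
    1ℚ ℚ.* probAt X (j + 0) c  ∎
    where open ≡-Reasoning
  occProb-∷ʳ (d ∷ Q) j c = begin
    probAt X j d ℚ.* occProb X (Q ∷ʳ c) (suc j)
      ≡⟨ cong (probAt X j d ℚ.*_) (occProb-∷ʳ Q (suc j) c) ⟩
    probAt X j d ℚ.* (occProb X Q (suc j) ℚ.* probAt X (suc j + length Q) c)
      ≡⟨ ℚ.*-assoc (probAt X j d) (occProb X Q (suc j)) _ ⟨
    occProb X (d ∷ Q) j ℚ.* probAt X (suc j + length Q) c
      ≡⟨ cong (λ k → occProb X (d ∷ Q) j ℚ.* probAt X k c) (ℕ.+-suc j (length Q)) ⟨
    occProb X (d ∷ Q) j ℚ.* probAt X (j + length (d ∷ Q)) c
      ∎
    where open ≡-Reasoning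

  occProb-∷ʳ-≥ : ∀ Q j c → n ≤ j + length Q → occProb X (Q ∷ʳ c) j ≡ 0ℚ
  occProb-∷ʳ-≥ Q j c n≤ =
    trans (occProb-∷ʳ Q j c) (trans (cong (occProb X Q j ℚ.*_) (probAt-≥ n≤ c)) (ℚ.*-zeroʳ (occProb X Q j)))

  module _ (w : IsWeighted X) where

    probAt-nonNeg : ∀ k c → 0ℚ ℚ.≤ probAt X k c
    probAt-nonNeg k c with k <? n
    ... | yes k<n = proj₁ w (fromℕ< k<n) c
    ... | no  _   = ℚ.≤-refl

    -- Beyond the end of X every letter has probability 0, so the row sum drops from 1 to 0.
    sumFin-probAt≤1 : ∀ k → sumFin (probAt X k) ℚ.≤ 1ℚ
    sumFin-probAt≤1 k = case k <? n of λ where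
        (yes k<n) → ℚ.≤-reflexive (begin
          sumFin (probAt X k)      ≡⟨ sumFin≡sum (probAt X k) ⟩
          ℚΣ.sum (probAt X k)      ≡⟨ ℚΣ.sum-cong-≗ (probAt-< k<n) ⟩
          ℚΣ.sum (X (fromℕ< k<n))  ≡⟨ sumFin≡sum (X (fromℕ< k<n)) ⟨
          sumFin (X (fromℕ< k<n))  ≡⟨ proj₂ w (fromℕ< k<n) ⟩
          1ℚ                       ∎)
        (no k≮n) → ℚ.≤-trans (ℚ.≤-reflexive (begin
          sumFin (probAt X k)      ≡⟨ sumFin≡sum (probAt X k) ⟩
          ℚΣ.sum (probAt X k)      ≡⟨ ℚΣ.sum-cong-≗ (probAt-≥ (ℕ.≮⇒≥ k≮n)) ⟩
          ℚΣ.sum {σ} (λ _ → 0ℚ)    ≡⟨ ℚΣ.sum-replicate-zero σ ⟩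
          0ℚ                       ∎)) 0≤1
      where open ≡-Reasoning

    occProb-nonNeg : ∀ Q j → 0ℚ ℚ.≤ occProb X Q j
    occProb-nonNeg []      j = 0≤1
    occProb-nonNeg (c ∷ Q) j = *-nonNeg (probAt-nonNeg j c) (occProb-nonNeg Q (suc j))

    sumFin-occProb-∷ʳ≤ : ∀ Q j → sumFin (λ c → occProb X (Q ∷ʳ c) j) ℚ.≤ occProb X Q j
    sumFin-occProb-∷ʳ≤ Q j = begin
      sumFin (λ c → occProb X (Q ∷ʳ c) j)  ≡⟨ sumFin≡sum (λ c → occProb X (Q ∷ʳ c) j) ⟩
      ℚΣ.sum (λ c → occProb X (Q ∷ʳ c) j)  ≡⟨ ℚΣ.sum-cong-≗ (occProb-∷ʳ Q j) ⟩
      ℚΣ.sum (λ c → o ℚ.* p c)             ≡⟨ ℚΣ.*-distribˡ-sum o p ⟨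
      o ℚ.* ℚΣ.sum p                       ≡⟨ cong (o ℚ.*_) (sumFin≡sum p) ⟨
      o ℚ.* sumFin p                       ≤⟨ ℚ.*-monoˡ-≤-nonNeg o {{nonNegative (occProb-nonNeg Q j)}} (sumFin-probAt≤1 _) ⟩
      o ℚ.* 1ℚ                             ≡⟨ ℚ.*-identityʳ o ⟩
      o                                    ∎
      where
      open ℚ.≤-Reasoning
      o = occProb X Q j
      p = probAt X (j + length Q)

module Thresholds {n σ : ℕ} (X : WSeq n σ) (w : IsWeighted X) {z : ℚ} (0≤z : 0ℚ ℚ.≤ z) (i : Fin n) where

  expected : Str σ → ℚ
  expected P = occProb X P (toℕ i) ℚ.* z

  sumFin-expected-∷ʳ≤ : ∀ Q → sumFin (expected ∘ (Q ∷ʳ_)) ℚ.≤ expected Q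
  sumFin-expected-∷ʳ≤ Q = begin
    sumFin (λ c → occ (Q ∷ʳ c) ℚ.* z)  ≡⟨ sumFin≡sum (λ c → occ (Q ∷ʳ c) ℚ.* z) ⟩
    ℚΣ.sum (λ c → occ (Q ∷ʳ c) ℚ.* z)  ≡⟨ ℚΣ.*-distribʳ-sum z (occ ∘ (Q ∷ʳ_)) ⟨
    ℚΣ.sum (occ ∘ (Q ∷ʳ_)) ℚ.* z       ≡⟨ cong (ℚ._* z) (sumFin≡sum (occ ∘ (Q ∷ʳ_))) ⟨
    sumFin (occ ∘ (Q ∷ʳ_)) ℚ.* z       ≤⟨ ℚ.*-monoʳ-≤-nonNeg z {{nonNegative 0≤z}} (sumFin-occProb-∷ʳ≤ X w Q (toℕ i)) ⟩
    expected Q                         ∎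
    where
    open ℚ.≤-Reasoning
    occ : Str σ → ℚ
    occ P = occProb X P (toℕ i)

  count : Str σ → ℕ
  count P = ∣ t X z i P ∣

  +count : ∀ P → + count P ≡ t X z i P
  +count P = ℤ.0≤i⇒+∣i∣≡i (floor-mono (*-nonNeg (occProb-nonNeg X w P (toℕ i)) 0≤z))

  count-vanishes : ∀ Q → suc n ≤ length Q → count Q ≡ 0
  count-vanishes Q n<|Q| with initLast Q
  count-vanishes .(Q ∷ʳ c) n<|Q| | Q ∷ʳ′ c =
    cong (λ q → ∣ floor q ∣) (trans (cong (ℚ._* z) (occProb-∷ʳ-≥ X Q (toℕ i) c n≤i+|Q|)) (ℚ.*-zeroˡ z))
    where
    n≤|Q| : n ≤ length Q
    n≤|Q| = s≤s⁻¹ (subst (suc n ≤_) (trans (length-++ Q) (ℕ.+-comm (length Q) 1)) n<|Q|)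
    n≤i+|Q| : n ≤ toℕ i + length Q
    n≤i+|Q| = ℕ.≤-trans n≤|Q| (ℕ.m≤n+m (length Q) (toℕ i))

  count-children : ∀ Q → ∑[ c < σ ] count (Q ∷ʳ c) ≤ count Q
  count-children Q = ℤ.drop‿+≤+ (begin
    + ∑[ c < σ ] count (Q ∷ʳ c)               ≡⟨ +-sum (count ∘ (Q ∷ʳ_)) ⟩
    ℤΣ.sum (λ c → + count (Q ∷ʳ c))           ≡⟨ ℤΣ.sum-cong-≗ (+count ∘ (Q ∷ʳ_)) ⟩
    ℤΣ.sum (λ c → floor (expected (Q ∷ʳ c)))  ≤⟨ sum-floor≤floor-sumFin (expected ∘ (Q ∷ʳ_)) ⟩
    floor (sumFin (expected ∘ (Q ∷ʳ_)))       ≤⟨ floor-mono (sumFin-expected-∷ʳ≤ Q) ⟩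
    floor (expected Q)                        ≡⟨ +count Q ⟨
    + count Q                                 ∎)
    where open ℤ.≤-Reasoning

lemma1 : ∀ (n σ : ℕ) (X : WSeq n σ) → IsWeighted X → (z : ℚ) → 0ℚ ℚ.< z → (i : Fin n) →
    Σ (List (Str σ)) λ M →
      (∀ (P : Str σ) → + prefixCount P M ≡ t X z i P) ×
      (∀ (M′ : List (Str σ)) → (∀ (P : Str σ) → + prefixCount P M′ ≡ t X z i P) → M′ ↭ M)
lemma1 n σ X w z 0<z i = M , M-prefixCounts , λ M′ M′-prefixCounts →
    prefixCount-injective λ P → ℤ.+-injective (trans (M′-prefixCounts P) (sym (M-prefixCounts P)))
  where
  open Thresholds X w (ℚ.<⇒≤ 0<z) i
  M : List (Str σ)
  M = fromPrefixCounts count (suc n)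
  M-prefixCounts : ∀ P → + prefixCount P M ≡ t X z i P
  M-prefixCounts P =
    trans (cong +_ (prefixCount-fromPrefixCounts (suc n) count count-vanishes count-children P)) (+count P)
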